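{- Let $I$ be a finite index set, and for each $i\in I$ let $G_i$ be a finite group and $L_i$ a finite lattice on which $G_i$ acts by order-preserving maps. Then for every $r\ge 1$, $$\widetilde{\chi}_r\Big(\big(\textstyle\prod_{i\in I}L_i\big)^*,\prod_{i\in I}G_i\Big)=\prod_{i\in I}\widetilde{\chi}_r(L_i^*,G_i),$$ where $\prod_i G_i$ acts componentwise on the product lattice $\prod_i L_i$.
   Context: For a lattice $L$ with least element $\hat 0$ and greatest element $\hat 1$, $L^*=L\setminus\{\hat 0,\hat 1\}$ is its proper part. For a finite poset $P$, $\widetilde{\chi}(P)$ is the reduced Euler characteristic of its order complex ($\widetilde{\chi}(\emptyset)=-1$). For a finite group $G$, a finite $G$-poset $\Pi$ and $H\le G$, $C_\Pi(H)$ is the subposet of $H$-fixed elements, and $\widetilde{\chi}_r(\Pi,G)=\frac{1}{|G|}\sum_{X\in\mathrm{Hom}(\mathbf{Z}^r,G)}\widetilde{\chi}(C_\Pi(X(\mathbf{Z}^r)))$. -}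

module Defs where

open import Level using (0ℓ)
open import Data.Nat as ℕ using (ℕ; zero; suc)
open import Data.Integer as ℤ using (ℤ; +_; -[1+_])
open import Data.Rational as ℚ using (ℚ)
open import Data.Fin using (Fin; zero; suc)
open import Data.Product using (_×_; _,_; proj₁; proj₂)
open import Data.Product.Properties using (≡-dec)
open import Data.Sum using (_⊎_)
open import Data.Vec as Vec using (Vec; []; _∷_)
open import Data.List as List using (List; []; _∷_; _++_; map; filter; length; cartesianProduct; foldr)
open import Data.List.Membership.Propositional using (_∈_)
open import Data.List.Relation.Unary.Unique.Propositional using (Unique)
open import Data.List.Relation.Unary.All using (All; all?)
open import Data.List.Relation.Unary.AllPairs using (AllPairs; allPairs?)
open import Relation.Nullary using (Dec; ¬_; does)
open import Relation.Nullary.Decidable using (_×-dec_; _⊎-dec_; ¬?)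
open import Relation.Binary using (Rel; Decidable; DecidableEquality)
open import Relation.Binary.PropositionalEquality using (_≡_)
open import Algebra.Structures using (IsGroup)
open import Relation.Binary.Lattice.Structures using (IsBoundedLattice)

record FinGroup : Set₁ where
  field
    Carrier  : Set
    _≟_      : DecidableEquality Carrier
    elems    : List Carrier
    complete : ∀ x → x ∈ elems
    unique   : Unique elems
    _∙_      : Carrier → Carrier → Carrier
    ε        : Carrier
    _⁻¹      : Carrier → Carrier
    isGroup  : IsGroup _≡_ _∙_ ε _⁻¹

-- A finite lattice; being finite and (non-empty) it is bounded, with
-- least element ⊥ (= 0̂) and greatest element ⊤ (= 1̂).
record FinLattice : Set₁ where
  field
    Carrier  : Set
    _≟_      : DecidableEquality Carrier
    elems    : List Carrier
    complete : ∀ x → x ∈ elems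
    unique   : Unique elems
    _≤_      : Rel Carrier 0ℓ
    _≤?_     : Decidable _≤_
    _∨_      : Carrier → Carrier → Carrier
    _∧_      : Carrier → Carrier → Carrier
    ⊤        : Carrier
    ⊥        : Carrier
    isBoundedLattice : IsBoundedLattice _≡_ _≤_ _∨_ _∧_ ⊤ ⊥

record Action (G : FinGroup) (L : FinLattice) : Set where
  private
    module G = FinGroup G
    module L = FinLattice L
  field
    act     : G.Carrier → L.Carrier → L.Carrier
    act-ε   : ∀ x → act G.ε x ≡ x
    act-∙   : ∀ g h x → act (g G.∙ h) x ≡ act g (act h x)
    act-mono : ∀ g {x y} → x L.≤ y → act g x L.≤ act g y

-- Raw (purely computational) data of a finite group acting on a finite
-- bounded poset: all that is needed to compute χ̃_r(L^*, G).

record RawGL : Set₁ where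
  field
    G     : Set
    _≟G_  : DecidableEquality G
    Gel   : List G
    _∙_   : G → G → G
    P     : Set
    _≟P_  : DecidableEquality P
    Pel   : List P
    _≤_   : Rel P 0ℓ
    _≤?_  : Decidable _≤_
    bot   : P
    top   : P
    act   : G → P → P

toRaw : (G : FinGroup) (L : FinLattice) → Action G L → RawGL
toRaw G L A = record
  { G = G.Carrier ; _≟G_ = G._≟_ ; Gel = G.elems ; _∙_ = G._∙_
  ; P = L.Carrier ; _≟P_ = L._≟_ ; Pel = L.elems ; _≤_ = L._≤_ ; _≤?_ = L._≤?_
  ; bot = L.⊥ ; top = L.⊤ ; act = Action.act A }
  where
    module G = FinGroup G
    module L = FinLattice L

_⊗_ : RawGL → RawGL → RawGL
R ⊗ S = record
  { G = R.G × S.G ; _≟G_ = ≡-dec R._≟G_ S._≟G_ ; Gel = cartesianProduct R.Gel S.Gel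
  ; _∙_ = λ g h → (proj₁ g R.∙ proj₁ h) , (proj₂ g S.∙ proj₂ h)
  ; P = R.P × S.P ; _≟P_ = ≡-dec R._≟P_ S._≟P_ ; Pel = cartesianProduct R.Pel S.Pel
  ; _≤_ = λ x y → (proj₁ x R.≤ proj₁ y) × (proj₂ x S.≤ proj₂ y)
  ; _≤?_ = λ x y → (proj₁ x R.≤? proj₁ y) ×-dec (proj₂ x S.≤? proj₂ y)
  ; bot = R.bot , S.bot ; top = R.top , S.top
  ; act = λ g x → R.act (proj₁ g) (proj₁ x) , S.act (proj₂ g) (proj₂ x) }
  where
    module R = RawGL R
    module S = RawGL S

-- Product over the (non-empty) finite index set I = Fin (suc k).
∏GL : (k : ℕ) → (Fin (suc k) → RawGL) → RawGL
∏GL zero    R = R zero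
∏GL (suc k) R = R zero ⊗ ∏GL k (λ i → R (suc i))

∏ℚ : (k : ℕ) → (Fin (suc k) → ℚ) → ℚ
∏ℚ zero    f = f zero
∏ℚ (suc k) f = f zero ℚ.* ∏ℚ k (λ i → f (suc i))

-- Reduced Euler characteristic of the order complex of a finite poset
-- (given by the list of its elements):
--   χ̃(P) = Σ_{c chain of P, c possibly empty} (-1)^(|c| - 1),
-- the empty chain contributing -1 (so χ̃(∅) = -1).

sublists : {A : Set} → List A → List (List A)
sublists []       = [] ∷ []
sublists (x ∷ xs) = map (x ∷_) (sublists xs) ++ sublists xs

sumℤ : List ℤ → ℤ
sumℤ = foldr ℤ._+_ (+ 0)

sign : ℕ → ℤ
sign zero          = + 1
sign (suc zero)    = -[1+ 0 ]
sign (suc (suc n)) = sign n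

redEuler : {A : Set} (_≤_ : Rel A 0ℓ) → Decidable _≤_ → List A → ℤ
redEuler _≤_ _≤?_ xs =
  sumℤ (map (λ c → sign (suc (length c)))
            (filter (allPairs? (λ x y → (x ≤? y) ⊎-dec (y ≤? x))) (sublists xs)))

tuples : {A : Set} → List A → (r : ℕ) → List (Vec A r)
tuples xs zero    = [] ∷ []
tuples xs (suc r) = List.concatMap (λ x → map (x ∷_) (tuples xs r)) xs

-- Hom(ℤ^r, G) ≅ r-tuples of pairwise commuting elements of G
-- (X ↦ (X(e₁), …, X(e_r))).
Hom : (R : RawGL) → (r : ℕ) → List (Vec (RawGL.G R) r)
Hom R r = filter (λ X → allPairs? (λ g h → (g ∙ h) ≟G (h ∙ g)) (Vec.toList X)) (tuples Gel r)
  where open RawGL R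

proper : (R : RawGL) → List (RawGL.P R)
proper R = filter (λ x → ¬? (x ≟P bot) ×-dec ¬? (x ≟P top)) Pel
  where open RawGL R

-- C_{L^*}(X(ℤ^r)): the elements of L^* fixed by the subgroup X(ℤ^r),
-- i.e. fixed by each of its generators X(e₁), …, X(e_r).
fixedProper : (R : RawGL) {r : ℕ} → Vec (RawGL.G R) r → List (RawGL.P R)
fixedProper R X = filter (λ x → all? (λ g → act g x ≟P x) (Vec.toList X)) (proper R)
  where open RawGL R

-- z / n in ℚ (n = |G| ≥ 1 for a group; the value at n = 0 is irrelevant).
divℕ : ℤ → ℕ → ℚ
divℕ z zero    = ℚ.0ℚ
divℕ z (suc n) = z ℚ./ suc n

χ̃ᵣ : ℕ → RawGL → ℚ
χ̃ᵣ r R = divℕ (sumℤ (map (λ X → redEuler _≤_ _≤?_ (fixedProper R X)) (Hom R r)))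
              (length Gel)
  where open RawGL R

module Submission where

-- For X ∈ Hom(ℤ^r, G) the fixed subposet U = C_L(X) of a lattice L still
-- contains 0̂ and 1̂, and C_{L*}(X) is its proper part.  By Philip Hall's
-- theorem the reduced Euler characteristic of the proper part of a finite
-- bounded poset U is the Möbius number μ_U(0̂, 1̂).  We take the chain sum
-- μ(x, y) = χ̃(open interval (x, y)) as the definition of μ, prove that it
-- satisfies the Möbius recursion Σ_{x ≤ z ≤ y} μ(x, z) = δ(x, y) (by
-- decomposing chains according to their largest element), and observe that
-- this recursion determines μ uniquely.  As (x, y) ↦ μ_U · μ_V also solves
-- the recursion on U × V, μ_{U×V} = μ_U · μ_V.
--
-- The fixed points of (X₁, X₂) in L₁ × L₂ are C(X₁) × C(X₂) and a tuple of
-- pairs commutes iff both component tuples do, so the sum defining χ̃_r over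
-- G₁ × G₂ factorises; dividing by |G₁ × G₂| = |G₁| |G₂| yields
-- χ̃_r(L₁ × L₂, G₁ × G₂) = χ̃_r(L₁, G₁) χ̃_r(L₂, G₂), and the theorem follows
-- by induction over the index set.

open import Defs
open import Level using (0ℓ)
open import Data.Bool using (Bool; true; false; if_then_else_; _∧_; _∨_; not)
open import Data.Bool.Properties
  using (∧-comm; ∧-zeroʳ; ∧-identityʳ; ∨-zeroʳ; ∧-conicalˡ; ∧-conicalʳ; T-≡; ∧-commutativeMonoid)
open import Data.Empty using (⊥-elim)
open import Data.Fin using (Fin; zero; suc)
open import Data.Integer using (ℤ; 0ℤ; 1ℤ; _+_; _*_; -_; _-_)
import Data.Integer.Properties as ℤP
open import Data.Integer.Tactic.RingSolver using (solve-∀)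
open import Algebra.Bundles using (CommutativeMonoid; AbelianGroup)
open import Algebra.Properties.Group (AbelianGroup.group ℤP.+-0-abelianGroup)
  using () renaming (∙-cancelʳ to +-cancelʳ)
open import Algebra.Properties.CommutativeSemigroup ℤP.+-commutativeSemigroup
  using () renaming (interchange to +-interchange)
open import Algebra.Properties.CommutativeSemigroup
  (CommutativeMonoid.commutativeSemigroup ∧-commutativeMonoid)
  using () renaming (interchange to ∧-interchange)
open import Data.List
  using (List; []; _∷_; _++_; map; length; cartesianProduct; filter; filterᵇ; concatMap)
import Data.List.Properties as ListP
open import Data.List.Membership.Propositional using (_∈_)
open import Data.List.Membership.Propositional.Properties
  using (∈-filter⁻; ∈-filter⁺; ∈-cartesianProduct⁺; ∈-cartesianProduct⁻)
open import Data.List.Relation.Unary.Any using (here; there)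
import Data.List.Relation.Unary.All as All
open import Data.List.Relation.Unary.AllPairs using (allPairs?)
open import Data.List.Relation.Unary.Unique.Propositional using (Unique; _∷_)
import Data.List.Relation.Unary.Unique.Propositional.Properties as UniqueP
open import Data.Nat as ℕ using (ℕ; zero; suc; _≤_)
import Data.Nat.Properties as ℕP
open import Data.Product using (_×_; _,_; proj₁; proj₂)
open import Data.Product.Properties using (≡-dec)
import Data.Rational as ℚ
import Data.Rational.Properties as ℚP
import Data.Rational.Unnormalised as ℚᵘ
import Data.Rational.Unnormalised.Properties as ℚᵘP
open import Data.Vec as Vec using (Vec; []; _∷_)
open import Function using (_∘_)
open import Function.Bundles using (Equivalence; mk⇔)
open import Relation.Binary using (Rel; Decidable; DecidableEquality; IsPartialOrder)
open import Relation.Binary.PropositionalEquality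
  using (_≡_; _≢_; refl; sym; trans; cong; cong₂; subst; isEquivalence; module ≡-Reasoning)
open import Relation.Binary.Lattice.Structures using (IsBoundedLattice)
open import Algebra.Structures using (IsGroup)
open import Relation.Nullary using (Dec; yes; no; does)
open import Relation.Nullary.Decidable using (_×-dec_; _⊎-dec_; T?; dec-true; dec-false; does-⇔)

private
  variable
    A B : Set

∑ : (A → ℤ) → List A → ℤ
∑ f xs = sumℤ (map f xs)

when : Bool → ℤ → ℤ
when b z = if b then z else 0ℤ

when-∧ : ∀ a b x y → when (a ∧ b) (x * y) ≡ when a x * when b y
when-∧ true  true  x y = refl
when-∧ true  false x y = sym (ℤP.*-zeroʳ x)
when-∧ false b     x y = sym (ℤP.*-zeroˡ (when b y))

∑-cong : {f g : A → ℤ} (xs : List A) → (∀ {x} → x ∈ xs → f x ≡ g x) → ∑ f xs ≡ ∑ g xs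
∑-cong []       f≗g = refl
∑-cong (x ∷ xs) f≗g = cong₂ _+_ (f≗g (here refl)) (∑-cong xs (f≗g ∘ there))

∑-zero : (xs : List A) → ∑ (λ _ → 0ℤ) xs ≡ 0ℤ
∑-zero []       = refl
∑-zero (x ∷ xs) = trans (ℤP.+-identityˡ _) (∑-zero xs)

∑-+ : (f g : A → ℤ) (xs : List A) → ∑ (λ x → f x + g x) xs ≡ ∑ f xs + ∑ g xs
∑-+ f g []       = refl
∑-+ f g (x ∷ xs) rewrite ∑-+ f g xs = +-interchange (f x) (g x) (∑ f xs) (∑ g xs)

∑-neg : (f : A → ℤ) (xs : List A) → ∑ (λ x → - f x) xs ≡ - ∑ f xs
∑-neg f []       = refl
∑-neg f (x ∷ xs) rewrite ∑-neg f xs = sym (ℤP.neg-distrib-+ (f x) (∑ f xs))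

∑-*ˡ : (c : ℤ) (f : A → ℤ) (xs : List A) → ∑ (λ x → c * f x) xs ≡ c * ∑ f xs
∑-*ˡ c f []       = sym (ℤP.*-zeroʳ c)
∑-*ˡ c f (x ∷ xs) rewrite ∑-*ˡ c f xs = sym (ℤP.*-distribˡ-+ c (f x) (∑ f xs))

∑-*ʳ : (c : ℤ) (f : A → ℤ) (xs : List A) → ∑ (λ x → f x * c) xs ≡ ∑ f xs * c
∑-*ʳ c f []       = refl
∑-*ʳ c f (x ∷ xs) rewrite ∑-*ʳ c f xs = sym (ℤP.*-distribʳ-+ c (f x) (∑ f xs))

∑-++ : (f : A → ℤ) (xs ys : List A) → ∑ f (xs ++ ys) ≡ ∑ f xs + ∑ f ys
∑-++ f []       ys = sym (ℤP.+-identityˡ _)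
∑-++ f (x ∷ xs) ys rewrite ∑-++ f xs ys = sym (ℤP.+-assoc (f x) (∑ f xs) (∑ f ys))

∑-map : (f : B → ℤ) (g : A → B) (xs : List A) → ∑ f (map g xs) ≡ ∑ (f ∘ g) xs
∑-map f g []       = refl
∑-map f g (x ∷ xs) = cong (f (g x) +_) (∑-map f g xs)

∑-concatMap : (h : B → ℤ) (f : A → List B) (xs : List A) →
  ∑ h (concatMap f xs) ≡ ∑ (λ x → ∑ h (f x)) xs
∑-concatMap h f []       = refl
∑-concatMap h f (x ∷ xs) =
  trans (∑-++ h (f x) (concatMap f xs)) (cong (∑ h (f x) +_) (∑-concatMap h f xs))

∑-cartesianProduct : (h : A × B → ℤ) (xs : List A) (ys : List B) →
  ∑ h (cartesianProduct xs ys) ≡ ∑ (λ x → ∑ (λ y → h (x , y)) ys) xs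
∑-cartesianProduct h []       ys = refl
∑-cartesianProduct h (x ∷ xs) ys = trans (∑-++ h (map (x ,_) ys) _)
  (cong₂ _+_ (∑-map h (x ,_) ys) (∑-cartesianProduct h xs ys))

∑-swap : (h : A → B → ℤ) (xs : List A) (ys : List B) →
  ∑ (λ x → ∑ (h x) ys) xs ≡ ∑ (λ y → ∑ (λ x → h x y) xs) ys
∑-swap h []       ys = sym (∑-zero ys)
∑-swap h (x ∷ xs) ys rewrite ∑-swap h xs ys = sym (∑-+ (h x) (λ y → ∑ (λ x → h x y) xs) ys)

∑-product : (f : A → ℤ) (g : B → ℤ) (xs : List A) (ys : List B) →
  ∑ (λ x → ∑ (λ y → f x * g y) ys) xs ≡ ∑ f xs * ∑ g ys
∑-product f g xs ys = trans (∑-cong xs (λ {x} _ → ∑-*ˡ (f x) g ys)) (∑-*ʳ (∑ g ys) f xs)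

∑-filterᵇ : (p : A → Bool) (f : A → ℤ) (xs : List A) →
  ∑ f (filterᵇ p xs) ≡ ∑ (λ x → when (p x) (f x)) xs
∑-filterᵇ p f []       = refl
∑-filterᵇ p f (x ∷ xs) with p x
... | true  = cong (f x +_) (∑-filterᵇ p f xs)
... | false = trans (∑-filterᵇ p f xs) (sym (ℤP.+-identityˡ _))

∑-delta : (_≟_ : DecidableEquality A) (f : A → ℤ) (xs : List A) → Unique xs →
  ∀ {x} → x ∈ xs → ∑ (λ z → when (does (z ≟ x)) (f z)) xs ≡ f x
∑-delta _≟_ f (y ∷ xs) (y∉xs ∷ _) {x} (here refl) with y ≟ y
... | no y≢y = ⊥-elim (y≢y refl)
... | yes _  = trans (cong (f y +_) (trans (∑-cong xs vanish) (∑-zero xs))) (ℤP.+-identityʳ (f y))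
  where
  vanish : ∀ {z} → z ∈ xs → when (does (z ≟ y)) (f z) ≡ 0ℤ
  vanish {z} z∈xs with z ≟ y
  ... | yes refl = ⊥-elim (All.lookup y∉xs z∈xs refl)
  ... | no _     = refl
∑-delta _≟_ f (y ∷ xs) (y∉xs ∷ u) {x} (there x∈xs) with y ≟ x
... | yes refl = ⊥-elim (All.lookup y∉xs x∈xs refl)
... | no _     = trans (ℤP.+-identityˡ _) (∑-delta _≟_ f xs u x∈xs)

filterᵇ-filterᵇ : (p q : A → Bool) (xs : List A) →
  filterᵇ p (filterᵇ q xs) ≡ filterᵇ (λ x → q x ∧ p x) xs
filterᵇ-filterᵇ p q [] = refl
filterᵇ-filterᵇ p q (x ∷ xs) with q x
... | false = filterᵇ-filterᵇ p q xs
... | true with p x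
...   | true  = cong (x ∷_) (filterᵇ-filterᵇ p q xs)
...   | false = filterᵇ-filterᵇ p q xs

filterᵇ-cong : {p q : A → Bool} (xs : List A) → (∀ {x} → x ∈ xs → p x ≡ q x) →
  filterᵇ p xs ≡ filterᵇ q xs
filterᵇ-cong {p = p} {q} [] p≗q = refl
filterᵇ-cong {p = p} {q} (x ∷ xs) p≗q with p x | q x | p≗q (here refl)
... | true  | .true  | refl = cong (x ∷_) (filterᵇ-cong xs (p≗q ∘ there))
... | false | .false | refl = filterᵇ-cong xs (p≗q ∘ there)

filterᵇ-none : (xs : List A) → filterᵇ (λ _ → false) xs ≡ []
filterᵇ-none []       = refl
filterᵇ-none (x ∷ xs) = filterᵇ-none xs

filterᵇ-map : (p : B → Bool) (g : A → B) (xs : List A) →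
  filterᵇ p (map g xs) ≡ map g (filterᵇ (p ∘ g) xs)
filterᵇ-map p g [] = refl
filterᵇ-map p g (x ∷ xs) with p (g x)
... | true  = cong (g x ∷_) (filterᵇ-map p g xs)
... | false = filterᵇ-map p g xs

filterᵇ-cartesianProduct : (p : A → Bool) (q : B → Bool) (xs : List A) (ys : List B) →
  filterᵇ (λ w → p (proj₁ w) ∧ q (proj₂ w)) (cartesianProduct xs ys)
    ≡ cartesianProduct (filterᵇ p xs) (filterᵇ q ys)
filterᵇ-cartesianProduct p q [] ys = refl
filterᵇ-cartesianProduct p q (x ∷ xs) ys =
  trans (ListP.filter-++ (T? ∘ pq) (map (x ,_) ys) (cartesianProduct xs ys))
        (trans (cong₂ _++_ (filterᵇ-map pq (x ,_) ys) (filterᵇ-cartesianProduct p q xs ys))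
               (split (p x) refl))
  where
  pq : _ → Bool
  pq w = p (proj₁ w) ∧ q (proj₂ w)
  split : (b : Bool) → p x ≡ b →
    map (x ,_) (filterᵇ (λ y → p x ∧ q y) ys) ++ cartesianProduct (filterᵇ p xs) (filterᵇ q ys)
      ≡ cartesianProduct (filterᵇ p (x ∷ xs)) (filterᵇ q ys)
  split true  px rewrite px = refl
  split false px rewrite px | filterᵇ-none ys = refl

filter-as-filterᵇ : {P : A → Set} (P? : (x : A) → Dec (P x)) (xs : List A) →
  filter P? xs ≡ filterᵇ (does ∘ P?) xs
filter-as-filterᵇ P? [] = refl
filter-as-filterᵇ P? (x ∷ xs) with does (P? x)
... | true  = cong (x ∷_) (filter-as-filterᵇ P? xs)
... | false = filter-as-filterᵇ P? xs

∈-filterᵇ⁻ : (p : A → Bool) {x : A} (xs : List A) → x ∈ filterᵇ p xs → x ∈ xs × p x ≡ true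
∈-filterᵇ⁻ p xs x∈ with ∈-filter⁻ (T? ∘ p) {xs = xs} x∈
... | x∈xs , px = x∈xs , Equivalence.to T-≡ px

∈-filterᵇ⁺ : (p : A → Bool) {x : A} (xs : List A) → x ∈ xs → p x ≡ true → x ∈ filterᵇ p xs
∈-filterᵇ⁺ p xs x∈xs px = ∈-filter⁺ (T? ∘ p) x∈xs (Equivalence.from T-≡ px)

length-filterᵇ-mono : (p q : A → Bool) (xs : List A) → (∀ x → p x ≡ true → q x ≡ true) →
  length (filterᵇ p xs) ≤ length (filterᵇ q xs)
length-filterᵇ-mono p q [] p⇒q = ℕ.z≤n
length-filterᵇ-mono p q (x ∷ xs) p⇒q with p x in px | q x in qx
... | true  | true  = ℕ.s≤s (length-filterᵇ-mono p q xs p⇒q)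
... | true  | false with () ← trans (sym (p⇒q x px)) qx
... | false | true  = ℕP.m≤n⇒m≤1+n (length-filterᵇ-mono p q xs p⇒q)
... | false | false = length-filterᵇ-mono p q xs p⇒q

length-filterᵇ-< : (p q : A → Bool) (xs : List A) {z : A} → z ∈ xs → p z ≡ false → q z ≡ true →
  (∀ x → p x ≡ true → q x ≡ true) → length (filterᵇ p xs) ℕ.< length (filterᵇ q xs)
length-filterᵇ-< p q (x ∷ xs) (here refl) pz qz p⇒q rewrite pz | qz =
  ℕ.s≤s (length-filterᵇ-mono p q xs p⇒q)
length-filterᵇ-< p q (x ∷ xs) (there z∈xs) pz qz p⇒q with p x in px | q x in qx
... | true  | true  = ℕ.s≤s (length-filterᵇ-< p q xs z∈xs pz qz p⇒q)
... | true  | false with () ← trans (sym (p⇒q x px)) qx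
... | false | true  = ℕP.m≤n⇒m≤1+n (length-filterᵇ-< p q xs z∈xs pz qz p⇒q)
... | false | false = length-filterᵇ-< p q xs z∈xs pz qz p⇒q

allᵇ : (A → Bool) → List A → Bool
allᵇ p []       = true
allᵇ p (x ∷ xs) = p x ∧ allᵇ p xs

allPairsᵇ : (A → A → Bool) → List A → Bool
allPairsᵇ r []       = true
allPairsᵇ r (x ∷ xs) = allᵇ (r x) xs ∧ allPairsᵇ r xs

does-all? : {P : A → Set} (P? : (x : A) → Dec (P x)) (xs : List A) →
  does (All.all? P? xs) ≡ allᵇ (does ∘ P?) xs
does-all? P? []       = refl
does-all? P? (x ∷ xs) = cong (does (P? x) ∧_) (does-all? P? xs)

does-allPairs? : {R : Rel A 0ℓ} (R? : Decidable R) (xs : List A) →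
  does (allPairs? R? xs) ≡ allPairsᵇ (λ x y → does (R? x y)) xs
does-allPairs? R? []       = refl
does-allPairs? R? (x ∷ xs) = cong₂ _∧_ (does-all? (R? x) xs) (does-allPairs? R? xs)

allᵇ-cong : {p q : A → Bool} (xs : List A) → (∀ x → p x ≡ q x) → allᵇ p xs ≡ allᵇ q xs
allᵇ-cong []       p≗q = refl
allᵇ-cong (x ∷ xs) p≗q = cong₂ _∧_ (p≗q x) (allᵇ-cong xs p≗q)

allPairsᵇ-cong : {r s : A → A → Bool} (xs : List A) → (∀ x y → r x y ≡ s x y) →
  allPairsᵇ r xs ≡ allPairsᵇ s xs
allPairsᵇ-cong []       r≗s = refl
allPairsᵇ-cong (x ∷ xs) r≗s = cong₂ _∧_ (allᵇ-cong xs (r≗s x)) (allPairsᵇ-cong xs r≗s)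

allᵇ-zip : {r : ℕ} (p : A → Bool) (q : B → Bool) (X : Vec A r) (Y : Vec B r) →
  allᵇ (λ g → p (proj₁ g) ∧ q (proj₂ g)) (Vec.toList (Vec.zip X Y))
    ≡ allᵇ p (Vec.toList X) ∧ allᵇ q (Vec.toList Y)
allᵇ-zip p q []      []      = refl
allᵇ-zip p q (x ∷ X) (y ∷ Y) rewrite allᵇ-zip p q X Y = ∧-interchange (p x) (q y) _ _

allPairsᵇ-zip : {r : ℕ} (s : A → A → Bool) (t : B → B → Bool) (X : Vec A r) (Y : Vec B r) →
  allPairsᵇ (λ g h → s (proj₁ g) (proj₁ h) ∧ t (proj₂ g) (proj₂ h)) (Vec.toList (Vec.zip X Y))
    ≡ allPairsᵇ s (Vec.toList X) ∧ allPairsᵇ t (Vec.toList Y)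
allPairsᵇ-zip s t []      []      = refl
allPairsᵇ-zip s t (x ∷ X) (y ∷ Y) rewrite allᵇ-zip (s x) (t y) X Y | allPairsᵇ-zip s t X Y =
  ∧-interchange (allᵇ (s x) (Vec.toList X)) (allᵇ (t y) (Vec.toList Y)) _ _

does-sound : {P : Set} (P? : Dec P) → does P? ≡ true → P
does-sound (yes p) _ = p

does-≡-dec : (_≟A_ : DecidableEquality A) (_≟B_ : DecidableEquality B) (a c : A) (b d : B) →
  does (≡-dec _≟A_ _≟B_ (a , b) (c , d)) ≡ does (a ≟A c) ∧ does (b ≟B d)
does-≡-dec _≟A_ _≟B_ a c b d =
  does-⇔ (mk⇔ (λ { refl → refl , refl }) (λ { (refl , refl) → refl }))
         (≡-dec _≟A_ _≟B_ (a , b) (c , d)) ((a ≟A c) ×-dec (b ≟B d))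

sign-suc : (n : ℕ) → sign (suc n) ≡ - sign n
sign-suc zero    = refl
sign-suc (suc n) rewrite sign-suc n = sym (ℤP.neg-involutive (sign n))

-- For c the
-- comparability relation of a poset this is the reduced Euler
-- characteristic of the order complex of xs.
chainSum : (A → A → Bool) → List A → ℤ
chainSum c xs = ∑ (λ ch → sign (suc (length ch))) (filterᵇ (allPairsᵇ c) (sublists xs))

redEuler-as-chainSum : {_≤_ : Rel A 0ℓ} (_≤?_ : Decidable _≤_) (xs : List A) →
  redEuler _≤_ _≤?_ xs ≡ chainSum (λ x y → does (x ≤? y) ∨ does (y ≤? x)) xs
redEuler-as-chainSum _≤?_ xs = cong (∑ (λ ch → sign (suc (length ch))))
  (trans (filter-as-filterᵇ _ (sublists xs))
         (filterᵇ-cong (sublists xs) (λ {ch} _ → does-allPairs? (λ x y → (x ≤? y) ⊎-dec (y ≤? x)) ch)))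

sublists-filterᵇ : (p : A → Bool) (xs : List A) →
  filterᵇ (allᵇ p) (sublists xs) ≡ sublists (filterᵇ p xs)
sublists-filterᵇ p [] = refl
sublists-filterᵇ p (y ∷ ys) =
  trans (ListP.filter-++ (T? ∘ allᵇ p) (map (y ∷_) (sublists ys)) (sublists ys))
        (trans (cong (_++ filterᵇ (allᵇ p) (sublists ys)) (filterᵇ-map (allᵇ p) (y ∷_) (sublists ys)))
               (split (p y) refl))
  where
  split : (b : Bool) → p y ≡ b →
    map (y ∷_) (filterᵇ (λ ch → p y ∧ allᵇ p ch) (sublists ys)) ++ filterᵇ (allᵇ p) (sublists ys)
      ≡ sublists (filterᵇ p (y ∷ ys))
  split true  py rewrite py | sublists-filterᵇ p ys = refl
  split false py rewrite py | filterᵇ-none (sublists ys) = sublists-filterᵇ p ys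

-- Splitting chains according to whether they contain x: the chains
-- through x are x prepended to the chains of elements c-related to x.
chainSum-cons : (c : A → A → Bool) (x : A) (xs : List A) →
  chainSum c (x ∷ xs) ≡ - chainSum c (filterᵇ (c x) xs) + chainSum c xs
chainSum-cons c x xs =
  trans (cong (∑ w) (ListP.filter-++ (T? ∘ allPairsᵇ c) (map (x ∷_) S) S))
        (trans (∑-++ w (filterᵇ (allPairsᵇ c) (map (x ∷_) S)) (filterᵇ (allPairsᵇ c) S))
               (cong (_+ chainSum c xs) chainsThrough-x))
  where
  S = sublists xs
  w : List _ → ℤ
  w ch = sign (suc (length ch))
  chainsThrough-x : ∑ w (filterᵇ (allPairsᵇ c) (map (x ∷_) S)) ≡ - chainSum c (filterᵇ (c x) xs)
  chainsThrough-x = begin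
    ∑ w (filterᵇ (allPairsᵇ c) (map (x ∷_) S))
      ≡⟨ cong (∑ w) (filterᵇ-map (allPairsᵇ c) (x ∷_) S) ⟩
    ∑ w (map (x ∷_) (filterᵇ (λ ch → allᵇ (c x) ch ∧ allPairsᵇ c ch) S))
      ≡⟨ cong (∑ w ∘ map (x ∷_)) (sym (filterᵇ-filterᵇ (allPairsᵇ c) (allᵇ (c x)) S)) ⟩
    ∑ w (map (x ∷_) (filterᵇ (allPairsᵇ c) (filterᵇ (allᵇ (c x)) S)))
      ≡⟨ cong (∑ w ∘ map (x ∷_) ∘ filterᵇ (allPairsᵇ c)) (sublists-filterᵇ (c x) xs) ⟩
    ∑ w (map (x ∷_) Cₓ)
      ≡⟨ ∑-map w (x ∷_) Cₓ ⟩
    ∑ (λ ch → sign (suc (suc (length ch)))) Cₓ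
      ≡⟨ ∑-cong Cₓ (λ {ch} _ → sign-suc (suc (length ch))) ⟩
    ∑ (λ ch → - w ch) Cₓ
      ≡⟨ ∑-neg w Cₓ ⟩
    - chainSum c (filterᵇ (c x) xs) ∎
    where
    open ≡-Reasoning
    Cₓ = filterᵇ (allPairsᵇ c) (sublists (filterᵇ (c x) xs))

-- A finite
-- subposet is given by a duplicate-free list U of elements of A; order
-- relations are evaluated as Booleans so that they can drive filters.

module Möbius {A : Set} (_≟_ : DecidableEquality A) {_⊑_ : Rel A 0ℓ} (_⊑?_ : Decidable _⊑_)
              (isPartialOrder : IsPartialOrder _≡_ _⊑_) where

  private
    module PO = IsPartialOrder isPartialOrder

  _≡ᵇ_ _≤ᵇ_ _<ᵇ_ _~ᵇ_ : A → A → Bool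
  x ≡ᵇ y = does (x ≟ y)
  x ≤ᵇ y = does (x ⊑? y)
  x <ᵇ y = x ≤ᵇ y ∧ not (x ≡ᵇ y)
  x ~ᵇ y = x ≤ᵇ y ∨ y ≤ᵇ x

  ≡ᵇ-refl : ∀ x → x ≡ᵇ x ≡ true
  ≡ᵇ-refl x = dec-true (x ≟ x) refl

  ≡ᵇ-sym : ∀ x y → x ≡ᵇ y ≡ y ≡ᵇ x
  ≡ᵇ-sym x y = does-⇔ (mk⇔ sym sym) (x ≟ y) (y ≟ x)

  ≡ᵇ-false : ∀ {x y} → x ≢ y → x ≡ᵇ y ≡ false
  ≡ᵇ-false {x} {y} = dec-false (x ≟ y)

  ≤ᵇ-refl : ∀ x → x ≤ᵇ x ≡ true
  ≤ᵇ-refl x = dec-true (x ⊑? x) PO.refl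

  ≤ᵇ-trans : ∀ {x y z} → x ≤ᵇ y ≡ true → y ≤ᵇ z ≡ true → x ≤ᵇ z ≡ true
  ≤ᵇ-trans {x} {y} {z} x≤y y≤z =
    dec-true (x ⊑? z) (PO.trans (does-sound (x ⊑? y) x≤y) (does-sound (y ⊑? z) y≤z))

  ≤ᵇ-antisym : ∀ {x y} → x ≤ᵇ y ≡ true → y ≤ᵇ x ≡ true → x ≡ y
  ≤ᵇ-antisym {x} {y} x≤y y≤x = PO.antisym (does-sound (x ⊑? y) x≤y) (does-sound (y ⊑? x) y≤x)

  <ᵇ-irrefl : ∀ x → x <ᵇ x ≡ false
  <ᵇ-irrefl x rewrite ≡ᵇ-refl x = ∧-zeroʳ (x ≤ᵇ x)

  <ᵇ⇒≤ᵇ : ∀ {x y} → x <ᵇ y ≡ true → x ≤ᵇ y ≡ true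
  <ᵇ⇒≤ᵇ {x} {y} x<y with x ≤ᵇ y
  ... | true = refl

  <ᵇ⇒≢ : ∀ {x y} → x <ᵇ y ≡ true → x ≢ y
  <ᵇ⇒≢ {x} x<x refl with () ← trans (sym (<ᵇ-irrefl x)) x<x

  <ᵇ-trans : ∀ {x y z} → x <ᵇ y ≡ true → y <ᵇ z ≡ true → x <ᵇ z ≡ true
  <ᵇ-trans {x} {y} {z} x<y y<z rewrite ≤ᵇ-trans (<ᵇ⇒≤ᵇ x<y) (<ᵇ⇒≤ᵇ y<z) with x ≟ z
  ... | no _     = refl
  ... | yes refl = ⊥-elim (<ᵇ⇒≢ y<z (≤ᵇ-antisym (<ᵇ⇒≤ᵇ y<z) (<ᵇ⇒≤ᵇ x<y)))

  χ̃ : List A → ℤ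
  χ̃ = chainSum _~ᵇ_

  below : A → List A → List A
  below z S = filterᵇ (_<ᵇ z) S

  below-below : (S : List A) {x z : A} → z <ᵇ x ≡ true → below z (below x S) ≡ below z S
  below-below S {x} {z} z<x = trans (filterᵇ-filterᵇ (_<ᵇ z) (_<ᵇ x) S) (filterᵇ-cong S (λ {w} _ → below-z w))
    where
    below-z : ∀ w → w <ᵇ x ∧ w <ᵇ z ≡ w <ᵇ z
    below-z w with w <ᵇ z in w<z
    ... | false = ∧-zeroʳ _
    ... | true rewrite <ᵇ-trans w<z z<x = refl

  below-comparable : (x z : A) (S : List A) → z ≢ x →
    when (x ~ᵇ z) (χ̃ (below z (filterᵇ (x ~ᵇ_) S)))
      ≡ when (z <ᵇ x) (χ̃ (below z S)) + when (x <ᵇ z) (χ̃ (filterᵇ (x ~ᵇ_) (below z S)))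
  below-comparable x z S z≢x rewrite ≡ᵇ-false z≢x | ≡ᵇ-false (z≢x ∘ sym)
    with x ≤ᵇ z in x≤z | z ≤ᵇ x in z≤x
  ... | true  | true  = ⊥-elim (z≢x (≤ᵇ-antisym z≤x x≤z))
  ... | false | false = refl
  ... | false | true  = trans (cong χ̃ below-z-comparable) (sym (ℤP.+-identityʳ _))
    where
    -- everything below z is below x, hence comparable to x
    below-z-comparable : below z (filterᵇ (x ~ᵇ_) S) ≡ below z S
    below-z-comparable = trans (filterᵇ-filterᵇ (_<ᵇ z) (x ~ᵇ_) S) (filterᵇ-cong S (λ {w} _ → keep w))
      where
      keep : ∀ w → (x ≤ᵇ w ∨ w ≤ᵇ x) ∧ w <ᵇ z ≡ w <ᵇ z
      keep w with w <ᵇ z in w<z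
      ... | false = ∧-zeroʳ _
      ... | true rewrite ≤ᵇ-trans (<ᵇ⇒≤ᵇ w<z) z≤x | ∨-zeroʳ (x ≤ᵇ w) = refl
  ... | true  | false = trans (cong χ̃ filters-commute) (sym (ℤP.+-identityˡ _))
    where
    filters-commute : below z (filterᵇ (x ~ᵇ_) S) ≡ filterᵇ (x ~ᵇ_) (below z S)
    filters-commute =
      trans (filterᵇ-filterᵇ (_<ᵇ z) (x ~ᵇ_) S)
            (trans (filterᵇ-cong S (λ {w} _ → ∧-comm (x ~ᵇ w) (w <ᵇ z)))
                   (sym (filterᵇ-filterᵇ (x ~ᵇ_) (_<ᵇ z) S)))

  below-cons : (x z : A) (S : List A) →
    χ̃ (below z (x ∷ S)) ≡ χ̃ (below z S) + - when (x <ᵇ z) (χ̃ (filterᵇ (x ~ᵇ_) (below z S)))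
  below-cons x z S with x <ᵇ z
  ... | true  = trans (chainSum-cons _~ᵇ_ x (below z S))
                      (ℤP.+-comm (- χ̃ (filterᵇ (x ~ᵇ_) (below z S))) (χ̃ (below z S)))
  ... | false = sym (ℤP.+-identityʳ _)

  -- Decomposing the chains of S by their largest element:
  -- χ̃(S) = -1 - Σ_{z ∈ S} χ̃(S_{<z}).  Induction on a bound n for |S|.
  χ̃-maxDecomposition : (n : ℕ) (S : List A) → length S ≤ n → Unique S →
    χ̃ S ≡ - 1ℤ - ∑ (λ z → χ̃ (below z S)) S
  χ̃-maxDecomposition n       []      _              _          = refl
  χ̃-maxDecomposition (suc n) (x ∷ T) (ℕ.s≤s |T|≤n) (x∉T ∷ T!) = begin
    χ̃ (x ∷ T)
      ≡⟨ chainSum-cons _~ᵇ_ x T ⟩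
    - χ̃ (filterᵇ (x ~ᵇ_) T) + χ̃ T
      ≡⟨ cong₂ (λ a b → - a + b) comparable-to-x (χ̃-maxDecomposition n T |T|≤n T!) ⟩
    - (- 1ℤ - (Cₓ + Bₓ)) + (- 1ℤ - Aₜ)
      ≡⟨ regroup (- 1ℤ) Cₓ Bₓ Aₜ ⟩
    - 1ℤ - ((- 1ℤ - Cₓ) + (Aₜ + - Bₓ))
      ≡⟨ cong (λ w → - 1ℤ - w) (sym (cong₂ _+_ below-x below-others)) ⟩
    - 1ℤ - (χ̃ (below x (x ∷ T)) + ∑ (λ z → χ̃ (below z (x ∷ T))) T) ∎
    where
    open ≡-Reasoning
    Aₜ = ∑ (λ z → χ̃ (below z T)) T
    Bₓ = ∑ (λ z → when (x <ᵇ z) (χ̃ (filterᵇ (x ~ᵇ_) (below z T)))) T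
    Cₓ = ∑ (λ z → when (z <ᵇ x) (χ̃ (below z T))) T

    regroup : ∀ m c b a → - (m - (c + b)) + (m - a) ≡ m - ((m - c) + (a + - b))
    regroup = solve-∀

    onFilter : (p : A → Bool) →
      χ̃ (filterᵇ p T) ≡ - 1ℤ - ∑ (λ z → when (p z) (χ̃ (below z (filterᵇ p T)))) T
    onFilter p =
      trans (χ̃-maxDecomposition n (filterᵇ p T)
               (ℕP.≤-trans (ListP.length-filter (T? ∘ p) T) |T|≤n) (UniqueP.filter⁺ (T? ∘ p) T!))
            (cong (λ w → - 1ℤ - w) (∑-filterᵇ p _ T))

    comparable-to-x : χ̃ (filterᵇ (x ~ᵇ_) T) ≡ - 1ℤ - (Cₓ + Bₓ)
    comparable-to-x = trans (onFilter (x ~ᵇ_)) (cong (λ w → - 1ℤ - w)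
      (trans (∑-cong T (λ z∈T → below-comparable x _ T (λ z≡x → All.lookup x∉T z∈T (sym z≡x))))
             (∑-+ _ _ T)))

    below-x : χ̃ (below x (x ∷ T)) ≡ - 1ℤ - Cₓ
    below-x rewrite <ᵇ-irrefl x =
      trans (onFilter (_<ᵇ x)) (cong (λ w → - 1ℤ - w) (∑-cong T (λ {z} _ → below-below-x z)))
      where
      below-below-x : ∀ z → when (z <ᵇ x) (χ̃ (below z (below x T))) ≡ when (z <ᵇ x) (χ̃ (below z T))
      below-below-x z with z <ᵇ x in z<x
      ... | false = refl
      ... | true  = cong χ̃ (below-below T z<x)

    below-others : ∑ (λ z → χ̃ (below z (x ∷ T))) T ≡ Aₜ + - Bₓ
    below-others = trans (∑-cong T (λ {z} _ → below-cons x z T))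
                         (trans (∑-+ _ _ T) (cong (Aₜ +_) (∑-neg _ T)))

  interval : List A → A → A → List A
  interval U x y = filterᵇ (λ z → x <ᵇ z ∧ z <ᵇ y) U

  -- μ_U(x, y) = 1 if x = y and χ̃((x, y)) otherwise.  By μ-recursion below
  -- (Philip Hall's theorem) this is the Möbius function of U.
  μ : List A → A → A → ℤ
  μ U x y = if x ≡ᵇ y then 1ℤ else χ̃ (interval U x y)

  μ-off-diagonal : (U : List A) {x y : A} → x ≢ y → μ U x y ≡ χ̃ (interval U x y)
  μ-off-diagonal U x≢y rewrite ≡ᵇ-false x≢y = refl

  δ : A → A → ℤ
  δ x y = when (x ≡ᵇ y) 1ℤ

  intervalSum : List A → (A → ℤ) → A → A → ℤ
  intervalSum U f x y = ∑ (λ z → when (x ≤ᵇ z ∧ z ≤ᵇ y) (f z)) U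

  below-interval : (U : List A) {x y z : A} → z ∈ interval U x y →
    below z (interval U x y) ≡ interval U x z
  below-interval U {x} {y} {z} z∈xy =
    trans (filterᵇ-filterᵇ (_<ᵇ z) (λ w → x <ᵇ w ∧ w <ᵇ y) U) (filterᵇ-cong U (λ {w} _ → below-z w))
    where
    z<y : z <ᵇ y ≡ true
    z<y with x <ᵇ z | proj₂ (∈-filterᵇ⁻ (λ w → x <ᵇ w ∧ w <ᵇ y) U z∈xy)
    ... | true | z<y = z<y
    below-z : ∀ w → (x <ᵇ w ∧ w <ᵇ y) ∧ w <ᵇ z ≡ x <ᵇ w ∧ w <ᵇ z
    below-z w with w <ᵇ z in w<z
    ... | false = trans (∧-zeroʳ _) (sym (∧-zeroʳ _))
    ... | true rewrite <ᵇ-trans w<z z<y = ∧-identityʳ _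

  χ̃-interval : (U : List A) → Unique U → (x y : A) →
    χ̃ (interval U x y) ≡ - 1ℤ - ∑ (λ z → χ̃ (interval U x z)) (interval U x y)
  χ̃-interval U U! x y =
    trans (χ̃-maxDecomposition (length I) I ℕP.≤-refl (UniqueP.filter⁺ _ U!))
          (cong (λ s → - 1ℤ - s) (∑-cong I (λ z∈I → cong χ̃ (below-interval U z∈I))))
    where I = interval U x y

  μ-term-split : (U : List A) {x y : A} → x ≤ᵇ y ≡ true → x ≢ y → (z : A) →
    when (x ≤ᵇ z ∧ z ≤ᵇ y) (μ U x z)
      ≡ δ z x + (when (z ≡ᵇ y) (χ̃ (interval U x y)) + when (x <ᵇ z ∧ z <ᵇ y) (χ̃ (interval U x z)))
  μ-term-split U {x} {y} x≤y x≢y z with z ≟ x | z ≟ y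
  ... | yes refl | yes refl = ⊥-elim (x≢y refl)
  ... | yes refl | no _  rewrite ≤ᵇ-refl z | x≤y | ≡ᵇ-refl z = refl
  ... | no _ | yes refl rewrite ≤ᵇ-refl z | x≤y | ≡ᵇ-false x≢y =
    sym (trans (ℤP.+-identityˡ _) (ℤP.+-identityʳ _))
  ... | no z≢x | no _ rewrite ≡ᵇ-false (z≢x ∘ sym) | ∧-identityʳ (x ≤ᵇ z) | ∧-identityʳ (z ≤ᵇ y) =
    sym (trans (ℤP.+-identityˡ _) (ℤP.+-identityˡ _))

  μ-term-diagonal : (U : List A) (x z : A) → when (x ≤ᵇ z ∧ z ≤ᵇ x) (μ U x z) ≡ δ z x
  μ-term-diagonal U x z with z ≟ x
  ... | yes refl rewrite ≤ᵇ-refl z | ≡ᵇ-refl z = refl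
  ... | no z≢x with x ≤ᵇ z in x≤z | z ≤ᵇ x in z≤x
  ...   | true  | true  = ⊥-elim (z≢x (≤ᵇ-antisym z≤x x≤z))
  ...   | true  | false = refl
  ...   | false | _     = refl

  μ-recursion : (U : List A) → Unique U → {x y : A} → x ∈ U → y ∈ U → x ≤ᵇ y ≡ true →
    intervalSum U (μ U x) x y ≡ δ x y
  μ-recursion U U! {x} {y} x∈U y∈U x≤y with x ≟ y
  ... | yes refl = trans (∑-cong U (λ {z} _ → μ-term-diagonal U x z)) (∑-delta _≟_ (λ _ → 1ℤ) U U! x∈U)
  ... | no x≢y = begin
    intervalSum U (μ U x) x y
      ≡⟨ ∑-cong U (λ {z} _ → μ-term-split U x≤y x≢y z) ⟩
    ∑ (λ z → δ z x + (when (z ≡ᵇ y) Iₓᵧ + when (inside z) (χ̃ (interval U x z)))) U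
      ≡⟨ trans (∑-+ _ _ U) (cong (∑ (λ z → δ z x) U +_) (∑-+ _ _ U)) ⟩
    ∑ (λ z → δ z x) U + (∑ (λ z → when (z ≡ᵇ y) Iₓᵧ) U + ∑ (λ z → when (inside z) (χ̃ (interval U x z))) U)
      ≡⟨ cong₂ (λ a b → a + (b + ∑ (λ z → when (inside z) (χ̃ (interval U x z))) U))
               (∑-delta _≟_ (λ _ → 1ℤ) U U! x∈U) (∑-delta _≟_ (λ _ → Iₓᵧ) U U! y∈U) ⟩
    1ℤ + (Iₓᵧ + ∑ (λ z → when (inside z) (χ̃ (interval U x z))) U)
      ≡⟨ cong (λ s → 1ℤ + (Iₓᵧ + s)) (sym (∑-filterᵇ inside _ U)) ⟩
    1ℤ + (Iₓᵧ + S)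
      ≡⟨ cong (λ i → 1ℤ + (i + S)) (χ̃-interval U U! x y) ⟩
    1ℤ + ((- 1ℤ - S) + S)
      ≡⟨ cancel 1ℤ S ⟩
    0ℤ ∎
    where
    open ≡-Reasoning
    inside : A → Bool
    inside z = x <ᵇ z ∧ z <ᵇ y
    Iₓᵧ = χ̃ (interval U x y)
    S = ∑ (λ z → χ̃ (interval U x z)) (interval U x y)
    cancel : ∀ a s → a + ((- a - s) + s) ≡ 0ℤ
    cancel = solve-∀

  intervalSum-top : (U : List A) → Unique U → (h : A → ℤ) {x y : A} → y ∈ U → x ≤ᵇ y ≡ true →
    intervalSum U h x y ≡ h y + ∑ (λ z → when (x ≤ᵇ z ∧ z <ᵇ y) (h z)) U
  intervalSum-top U U! h {x} {y} y∈U x≤y =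
    trans (∑-cong U (λ {z} _ → term z))
          (trans (∑-+ _ _ U) (cong (_+ ∑ (λ z → when (x ≤ᵇ z ∧ z <ᵇ y) (h z)) U) (∑-delta _≟_ h U U! y∈U)))
    where
    term : ∀ z → when (x ≤ᵇ z ∧ z ≤ᵇ y) (h z) ≡ when (z ≡ᵇ y) (h z) + when (x ≤ᵇ z ∧ z <ᵇ y) (h z)
    term z with z ≟ y
    ... | yes refl rewrite x≤y | ≤ᵇ-refl z = sym (ℤP.+-identityʳ _)
    ... | no _     rewrite ∧-identityʳ (z ≤ᵇ y) = sym (ℤP.+-identityˡ _)

  -- The Möbius recursion has at most one solution: functions with the same
  -- closed-interval sums over all [x, y] agree at every y ≥ x.  Induction on
  -- the number of elements below y.
  intervalSum-injective : (U : List A) → Unique U → (x : A) (f g : A → ℤ) →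
    (∀ {y} → y ∈ U → x ≤ᵇ y ≡ true → intervalSum U f x y ≡ intervalSum U g x y) →
    ∀ {y} → y ∈ U → x ≤ᵇ y ≡ true → f y ≡ g y
  intervalSum-injective U U! x f g sums≡ {y} = agree (suc (length (below y U))) ℕP.≤-refl
    where
    agree : (n : ℕ) → ∀ {y} → length (below y U) ℕ.< n → y ∈ U → x ≤ᵇ y ≡ true → f y ≡ g y
    agree (suc n) {y} (ℕ.s≤s |<y|≤n) y∈U x≤y = +-cancelʳ _ (f y) (g y) (begin
      f y + ∑ (lower f) U  ≡⟨ sym (intervalSum-top U U! f y∈U x≤y) ⟩
      intervalSum U f x y  ≡⟨ sums≡ y∈U x≤y ⟩
      intervalSum U g x y  ≡⟨ intervalSum-top U U! g y∈U x≤y ⟩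
      g y + ∑ (lower g) U  ≡⟨ cong (g y +_) (sym (∑-cong U (λ {z} → lower-agree z))) ⟩
      g y + ∑ (lower f) U  ∎)
      where
      open ≡-Reasoning
      lower : (A → ℤ) → A → ℤ
      lower h z = when (x ≤ᵇ z ∧ z <ᵇ y) (h z)
      -- every z < y has fewer elements below it than y
      lower-agree : ∀ z → z ∈ U → lower f z ≡ lower g z
      lower-agree z z∈U with x ≤ᵇ z in x≤z | z <ᵇ y in z<y
      ... | true  | true  = agree n (ℕP.<-≤-trans fewer-below |<y|≤n) z∈U x≤z
        where
        fewer-below : length (below z U) ℕ.< length (below y U)
        fewer-below = length-filterᵇ-< (_<ᵇ z) (_<ᵇ y) U z∈U (<ᵇ-irrefl z) z<y (λ w w<z → <ᵇ-trans w<z z<y)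
      ... | true  | false = refl
      ... | false | _     = refl

  proper-as-interval : (bot top : A) → (∀ z → bot ≤ᵇ z ≡ true) → (∀ z → z ≤ᵇ top ≡ true) →
    (p : A → Bool) (L : List A) →
    filterᵇ (λ z → (not (z ≡ᵇ bot) ∧ not (z ≡ᵇ top)) ∧ p z) L ≡ interval (filterᵇ p L) bot top
  proper-as-interval bot top bot≤ ≤top p L =
    trans (filterᵇ-cong L (λ {z} _ → reorder z)) (sym (filterᵇ-filterᵇ _ p L))
    where
    reorder : ∀ z → (not (z ≡ᵇ bot) ∧ not (z ≡ᵇ top)) ∧ p z ≡ p z ∧ (bot <ᵇ z ∧ z <ᵇ top)
    reorder z rewrite bot≤ z | ≤top z | ≡ᵇ-sym bot z = ∧-comm _ (p z)

componentwise-isPartialOrder : {_⊑A_ : Rel A 0ℓ} {_⊑B_ : Rel B 0ℓ} →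
  IsPartialOrder _≡_ _⊑A_ → IsPartialOrder _≡_ _⊑B_ →
  IsPartialOrder _≡_ (λ x y → (proj₁ x ⊑A proj₁ y) × (proj₂ x ⊑B proj₂ y))
componentwise-isPartialOrder poA poB = record
  { isPreorder = record
    { isEquivalence = isEquivalence
    ; reflexive     = λ { refl → A.refl , B.refl }
    ; trans         = λ (x₁ , x₂) (y₁ , y₂) → A.trans x₁ y₁ , B.trans x₂ y₂
    }
  ; antisym = λ (x₁ , x₂) (y₁ , y₂) → cong₂ _,_ (A.antisym x₁ y₁) (B.antisym x₂ y₂)
  }
  where
  module A = IsPartialOrder poA
  module B = IsPartialOrder poB

module MöbiusProduct {A B : Set}
  (_≟A_ : DecidableEquality A) {_⊑A_ : Rel A 0ℓ} (_⊑A?_ : Decidable _⊑A_) (poA : IsPartialOrder _≡_ _⊑A_)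
  (_≟B_ : DecidableEquality B) {_⊑B_ : Rel B 0ℓ} (_⊑B?_ : Decidable _⊑B_) (poB : IsPartialOrder _≡_ _⊑B_)
  where

  module MA = Möbius _≟A_ _⊑A?_ poA
  module MB = Möbius _≟B_ _⊑B?_ poB
  module MP = Möbius (≡-dec _≟A_ _≟B_) (λ x y → (proj₁ x ⊑A? proj₁ y) ×-dec (proj₂ x ⊑B? proj₂ y))
                     (componentwise-isPartialOrder poA poB)

  δ-product : (a c : A) (b d : B) → MP.δ (a , b) (c , d) ≡ MA.δ a c * MB.δ b d
  δ-product a c b d =
    trans (cong (λ t → when t 1ℤ) (does-≡-dec _≟A_ _≟B_ a c b d)) (when-∧ (MA._≡ᵇ_ a c) (MB._≡ᵇ_ b d) 1ℤ 1ℤ)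

  -- Closed intervals of U × V are products of closed intervals, so interval
  -- sums of a separated function factorise.
  intervalSum-product : (UA : List A) (UB : List B) (f : A → ℤ) (g : B → ℤ) (a c : A) (b d : B) →
    MP.intervalSum (cartesianProduct UA UB) (λ w → f (proj₁ w) * g (proj₂ w)) (a , b) (c , d)
      ≡ MA.intervalSum UA f a c * MB.intervalSum UB g b d
  intervalSum-product UA UB f g a c b d =
    trans (∑-cartesianProduct _ UA UB)
          (trans (∑-cong UA (λ {u} _ → ∑-cong UB (λ {v} _ → separate u v))) (∑-product _ _ UA UB))
    where
    separate : ∀ u v →
      when ((MA._≤ᵇ_ a u ∧ MB._≤ᵇ_ b v) ∧ (MA._≤ᵇ_ u c ∧ MB._≤ᵇ_ v d)) (f u * g v)
        ≡ when (MA._≤ᵇ_ a u ∧ MA._≤ᵇ_ u c) (f u) * when (MB._≤ᵇ_ b v ∧ MB._≤ᵇ_ v d) (g v)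
    separate u v =
      trans (cong (λ t → when t (f u * g v)) (∧-interchange (MA._≤ᵇ_ a u) (MB._≤ᵇ_ b v) (MA._≤ᵇ_ u c) (MB._≤ᵇ_ v d)))
            (when-∧ (MA._≤ᵇ_ a u ∧ MA._≤ᵇ_ u c) (MB._≤ᵇ_ b v ∧ MB._≤ᵇ_ v d) (f u) (g v))

  -- μ_{U×V}((a, b), (c, d)) = μ_U(a, c) · μ_V(b, d): the right-hand side
  -- also satisfies the Möbius recursion on U × V, which has one solution.
  μ-product : (UA : List A) (UB : List B) → Unique UA → Unique UB → {a c : A} {b d : B} →
    a ∈ UA → b ∈ UB → c ∈ UA → d ∈ UB → MA._≤ᵇ_ a c ≡ true → MB._≤ᵇ_ b d ≡ true →
    MP.μ (cartesianProduct UA UB) (a , b) (c , d) ≡ MA.μ UA a c * MB.μ UB b d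
  μ-product UA UB UA! UB! {a} {c} {b} {d} a∈UA b∈UB c∈UA d∈UB a≤c b≤d =
    MP.intervalSum-injective U U! (a , b) (MP.μ U (a , b)) μ⊗μ same-sums
      (∈-cartesianProduct⁺ c∈UA d∈UB) (cong₂ _∧_ a≤c b≤d)
    where
    U = cartesianProduct UA UB
    U! = UniqueP.cartesianProduct⁺ UA! UB!
    μ⊗μ : A × B → ℤ
    μ⊗μ w = MA.μ UA a (proj₁ w) * MB.μ UB b (proj₂ w)
    same-sums : ∀ {y} → y ∈ U → MP._≤ᵇ_ (a , b) y ≡ true →
      MP.intervalSum U (MP.μ U (a , b)) (a , b) y ≡ MP.intervalSum U μ⊗μ (a , b) y
    same-sums {c′ , d′} y∈U ab≤y = begin
      MP.intervalSum U (MP.μ U (a , b)) (a , b) (c′ , d′)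
        ≡⟨ MP.μ-recursion U U! (∈-cartesianProduct⁺ a∈UA b∈UB) y∈U ab≤y ⟩
      MP.δ (a , b) (c′ , d′)
        ≡⟨ δ-product a c′ b d′ ⟩
      MA.δ a c′ * MB.δ b d′
        ≡⟨ sym (cong₂ _*_ (MA.μ-recursion UA UA! a∈UA (proj₁ y∈UA×UB) (∧-conicalˡ _ _ ab≤y))
                          (MB.μ-recursion UB UB! b∈UB (proj₂ y∈UA×UB) (∧-conicalʳ _ _ ab≤y))) ⟩
      MA.intervalSum UA (MA.μ UA a) a c′ * MB.intervalSum UB (MB.μ UB b) b d′
        ≡⟨ sym (intervalSum-product UA UB (MA.μ UA a) (MB.μ UB b) a c′ b d′) ⟩
      MP.intervalSum U μ⊗μ (a , b) (c′ , d′) ∎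
      where
      open ≡-Reasoning
      y∈UA×UB = ∈-cartesianProduct⁻ UA UB y∈U

record IsBoundedGPoset (R : RawGL) : Set where
  open RawGL R renaming (_≤_ to _⊑_)
  field
    Pel-unique     : Unique Pel
    Pel-complete   : ∀ x → x ∈ Pel
    isPartialOrder : IsPartialOrder _≡_ _⊑_
    bot-least      : ∀ x → bot ⊑ x
    top-greatest   : ∀ x → x ⊑ top
    bot≢top        : bot ≢ top
    act-bot        : ∀ g → act g bot ≡ bot
    act-top        : ∀ g → act g top ≡ top

-- A group acting by order-preserving maps acts by order automorphisms,
-- which fix the least and the greatest element.
toRaw-isBoundedGPoset : (G : FinGroup) (L : FinLattice) (A : Action G L) →
  FinLattice.⊥ L ≢ FinLattice.⊤ L → IsBoundedGPoset (toRaw G L A)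
toRaw-isBoundedGPoset G L A ⊥≢⊤ = record
  { Pel-unique     = L.unique
  ; Pel-complete   = L.complete
  ; isPartialOrder = BL.isPartialOrder
  ; bot-least      = BL.minimum
  ; top-greatest   = BL.maximum
  ; bot≢top        = ⊥≢⊤
  ; act-bot        = λ g → BL.antisym (subst (act g L.⊥ L.≤_) (act-inverse g L.⊥) (act-mono g (BL.minimum _)))
                                      (BL.minimum _)
  ; act-top        = λ g → BL.antisym (BL.maximum _)
                                      (subst (L._≤ act g L.⊤) (act-inverse g L.⊤) (act-mono g (BL.maximum _)))
  }
  where
  module G = FinGroup G
  module L = FinLattice L
  module BL = IsBoundedLattice L.isBoundedLattice
  open Action A
  act-inverse : ∀ g x → act g (act (g G.⁻¹) x) ≡ x
  act-inverse g x = begin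
    act g (act (g G.⁻¹) x) ≡⟨ sym (act-∙ g (g G.⁻¹) x) ⟩
    act (g G.∙ (g G.⁻¹)) x ≡⟨ cong (λ h → act h x) (IsGroup.inverseʳ G.isGroup g) ⟩
    act G.ε x              ≡⟨ act-ε x ⟩
    x                      ∎
    where open ≡-Reasoning

⊗-isBoundedGPoset : (R S : RawGL) → IsBoundedGPoset R → IsBoundedGPoset S → IsBoundedGPoset (R ⊗ S)
⊗-isBoundedGPoset R S R-bounded S-bounded = record
  { Pel-unique     = UniqueP.cartesianProduct⁺ BR.Pel-unique BS.Pel-unique
  ; Pel-complete   = λ z → ∈-cartesianProduct⁺ (BR.Pel-complete (proj₁ z)) (BS.Pel-complete (proj₂ z))
  ; isPartialOrder = componentwise-isPartialOrder BR.isPartialOrder BS.isPartialOrder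
  ; bot-least      = λ z → BR.bot-least (proj₁ z) , BS.bot-least (proj₂ z)
  ; top-greatest   = λ z → BR.top-greatest (proj₁ z) , BS.top-greatest (proj₂ z)
  ; bot≢top        = λ bot≡top → BR.bot≢top (cong proj₁ bot≡top)
  ; act-bot        = λ g → cong₂ _,_ (BR.act-bot (proj₁ g)) (BS.act-bot (proj₂ g))
  ; act-top        = λ g → cong₂ _,_ (BR.act-top (proj₁ g)) (BS.act-top (proj₂ g))
  }
  where
  module BR = IsBoundedGPoset R-bounded
  module BS = IsBoundedGPoset S-bounded

∏GL-isBoundedGPoset : (k : ℕ) (R : Fin (suc k) → RawGL) → (∀ i → IsBoundedGPoset (R i)) →
  IsBoundedGPoset (∏GL k R)
∏GL-isBoundedGPoset zero    R bounded = bounded zero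
∏GL-isBoundedGPoset (suc k) R bounded =
  ⊗-isBoundedGPoset (R zero) (∏GL k (R ∘ suc)) (bounded zero) (∏GL-isBoundedGPoset k (R ∘ suc) (bounded ∘ suc))

module FixedPoints (R : RawGL) (R-bounded : IsBoundedGPoset R) where
  open RawGL R renaming (_≤_ to _⊑_; _≤?_ to _⊑?_)
  open IsBoundedGPoset R-bounded
  open Möbius _≟P_ _⊑?_ isPartialOrder public

  fixedᵇ : {r : ℕ} → Vec G r → P → Bool
  fixedᵇ X z = allᵇ (λ g → act g z ≡ᵇ z) (Vec.toList X)

  Fix : {r : ℕ} → Vec G r → List P
  Fix X = filterᵇ (fixedᵇ X) Pel

  bot∈Fix : {r : ℕ} (X : Vec G r) → bot ∈ Fix X
  bot∈Fix X = ∈-filterᵇ⁺ (fixedᵇ X) Pel (Pel-complete bot) (fixes-bot X)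
    where
    fixes-bot : {r : ℕ} (X : Vec G r) → fixedᵇ X bot ≡ true
    fixes-bot []      = refl
    fixes-bot (g ∷ X) rewrite dec-true (act g bot ≟P bot) (act-bot g) = fixes-bot X

  top∈Fix : {r : ℕ} (X : Vec G r) → top ∈ Fix X
  top∈Fix X = ∈-filterᵇ⁺ (fixedᵇ X) Pel (Pel-complete top) (fixes-top X)
    where
    fixes-top : {r : ℕ} (X : Vec G r) → fixedᵇ X top ≡ true
    fixes-top []      = refl
    fixes-top (g ∷ X) rewrite dec-true (act g top ≟P top) (act-top g) = fixes-top X

  fixedProper-as-filterᵇ : {r : ℕ} (X : Vec G r) →
    fixedProper R X ≡ filterᵇ (λ z → (not (z ≡ᵇ bot) ∧ not (z ≡ᵇ top)) ∧ fixedᵇ X z) Pel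
  fixedProper-as-filterᵇ X =
    trans (filter-as-filterᵇ _ (proper R))
          (trans (cong (filterᵇ _) (filter-as-filterᵇ _ Pel))
                 (trans (filterᵇ-filterᵇ _ _ Pel)
                        (filterᵇ-cong Pel (λ {z} _ → cong ((not (z ≡ᵇ bot) ∧ not (z ≡ᵇ top)) ∧_)
                                                          (does-all? (λ g → act g z ≟P z) (Vec.toList X))))))

  χ̃-fixedProper : {r : ℕ} (X : Vec G r) → redEuler _⊑_ _⊑?_ (fixedProper R X) ≡ μ (Fix X) bot top
  χ̃-fixedProper X = begin
    redEuler _⊑_ _⊑?_ (fixedProper R X)
      ≡⟨ redEuler-as-chainSum _⊑?_ (fixedProper R X) ⟩
    χ̃ (fixedProper R X)
      ≡⟨ cong χ̃ (fixedProper-as-filterᵇ X) ⟩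
    χ̃ (filterᵇ (λ z → (not (z ≡ᵇ bot) ∧ not (z ≡ᵇ top)) ∧ fixedᵇ X z) Pel)
      ≡⟨ cong χ̃ (proper-as-interval bot top (λ z → dec-true (bot ⊑? z) (bot-least z))
                                             (λ z → dec-true (z ⊑? top) (top-greatest z)) (fixedᵇ X) Pel) ⟩
    χ̃ (interval (Fix X) bot top)
      ≡⟨ sym (μ-off-diagonal (Fix X) bot≢top) ⟩
    μ (Fix X) bot top ∎
    where open ≡-Reasoning

χ̃-fixedProper-⊗ : (R S : RawGL) (R-bounded : IsBoundedGPoset R) (S-bounded : IsBoundedGPoset S)
  {r : ℕ} (X : Vec (RawGL.G R) r) (Y : Vec (RawGL.G S) r) →
  redEuler (RawGL._≤_ (R ⊗ S)) (RawGL._≤?_ (R ⊗ S)) (fixedProper (R ⊗ S) (Vec.zip X Y))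
    ≡ redEuler (RawGL._≤_ R) (RawGL._≤?_ R) (fixedProper R X)
      * redEuler (RawGL._≤_ S) (RawGL._≤?_ S) (fixedProper S Y)
χ̃-fixedProper-⊗ R S R-bounded S-bounded X Y = begin
  redEuler (RawGL._≤_ (R ⊗ S)) (RawGL._≤?_ (R ⊗ S)) (fixedProper (R ⊗ S) (Vec.zip X Y))
    ≡⟨ FRS.χ̃-fixedProper (Vec.zip X Y) ⟩
  FRS.μ (FRS.Fix (Vec.zip X Y)) (R.bot , S.bot) (R.top , S.top)
    ≡⟨ cong (λ U → FRS.μ U (R.bot , S.bot) (R.top , S.top)) Fix-zip ⟩
  FRS.μ (cartesianProduct (FR.Fix X) (FS.Fix Y)) (R.bot , S.bot) (R.top , S.top)
    ≡⟨ μ-product (FR.Fix X) (FS.Fix Y) (UniqueP.filter⁺ _ BR.Pel-unique) (UniqueP.filter⁺ _ BS.Pel-unique)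
                 (FR.bot∈Fix X) (FS.bot∈Fix Y) (FR.top∈Fix X) (FS.top∈Fix Y)
                 (dec-true (R.bot R.≤? R.top) (BR.bot-least R.top))
                 (dec-true (S.bot S.≤? S.top) (BS.bot-least S.top)) ⟩
  FR.μ (FR.Fix X) R.bot R.top * FS.μ (FS.Fix Y) S.bot S.top
    ≡⟨ sym (cong₂ _*_ (FR.χ̃-fixedProper X) (FS.χ̃-fixedProper Y)) ⟩
  redEuler R._≤_ R._≤?_ (fixedProper R X) * redEuler S._≤_ S._≤?_ (fixedProper S Y) ∎
  where
  open ≡-Reasoning
  module R = RawGL R
  module S = RawGL S
  module BR = IsBoundedGPoset R-bounded
  module BS = IsBoundedGPoset S-bounded
  module FR = FixedPoints R R-bounded
  module FS = FixedPoints S S-bounded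
  module FRS = FixedPoints (R ⊗ S) (⊗-isBoundedGPoset R S R-bounded S-bounded)
  open MöbiusProduct R._≟P_ R._≤?_ BR.isPartialOrder S._≟P_ S._≤?_ BS.isPartialOrder using (μ-product)

  fixedᵇ-zip : ∀ z → FRS.fixedᵇ (Vec.zip X Y) z ≡ FR.fixedᵇ X (proj₁ z) ∧ FS.fixedᵇ Y (proj₂ z)
  fixedᵇ-zip (a , b) =
    trans (allᵇ-cong (Vec.toList (Vec.zip X Y))
                     (λ g → does-≡-dec R._≟P_ S._≟P_ (R.act (proj₁ g) a) a (S.act (proj₂ g) b) b))
          (allᵇ-zip (λ g → FR._≡ᵇ_ (R.act g a) a) (λ h → FS._≡ᵇ_ (S.act h b) b) X Y)

  Fix-zip : FRS.Fix (Vec.zip X Y) ≡ cartesianProduct (FR.Fix X) (FS.Fix Y)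
  Fix-zip = trans (filterᵇ-cong (cartesianProduct R.Pel S.Pel) (λ {z} _ → fixedᵇ-zip z))
                  (filterᵇ-cartesianProduct (FR.fixedᵇ X) (FS.fixedᵇ Y) R.Pel S.Pel)

commutesᵇ : (R : RawGL) {r : ℕ} → Vec (RawGL.G R) r → Bool
commutesᵇ R X = allPairsᵇ (λ g h → does ((g ∙ h) ≟G (h ∙ g))) (Vec.toList X)
  where open RawGL R

∑-Hom : (R : RawGL) (r : ℕ) (F : Vec (RawGL.G R) r → ℤ) →
  ∑ F (Hom R r) ≡ ∑ (λ X → when (commutesᵇ R X) (F X)) (tuples (RawGL.Gel R) r)
∑-Hom R r F =
  trans (cong (∑ F) (filter-as-filterᵇ _ (tuples Gel r)))
        (trans (∑-filterᵇ _ F (tuples Gel r))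
               (∑-cong (tuples Gel r) (λ {X} _ → cong (λ b → when b (F X))
                                                   (does-allPairs? (λ g h → (g ∙ h) ≟G (h ∙ g)) (Vec.toList X)))))
  where open RawGL R

commutesᵇ-zip : (R S : RawGL) {r : ℕ} (X : Vec (RawGL.G R) r) (Y : Vec (RawGL.G S) r) →
  commutesᵇ (R ⊗ S) (Vec.zip X Y) ≡ commutesᵇ R X ∧ commutesᵇ S Y
commutesᵇ-zip R S X Y =
  trans (allPairsᵇ-cong (Vec.toList (Vec.zip X Y))
                        (λ g h → does-≡-dec R._≟G_ S._≟G_ _ _ _ _))
        (allPairsᵇ-zip (λ g h → does ((g R.∙ h) R.≟G (h R.∙ g))) (λ g h → does ((g S.∙ h) S.≟G (h S.∙ g))) X Y)
  where
  module R = RawGL R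
  module S = RawGL S

∑-tuples-suc : (xs : List A) (r : ℕ) (h : Vec A (suc r) → ℤ) →
  ∑ h (tuples xs (suc r)) ≡ ∑ (λ x → ∑ (λ X → h (x ∷ X)) (tuples xs r)) xs
∑-tuples-suc xs r h = trans (∑-concatMap h _ xs) (∑-cong xs (λ {x} _ → ∑-map h (x ∷_) (tuples xs r)))

∑-tuples-cartesianProduct : (xs : List A) (ys : List B) (r : ℕ) (h : Vec (A × B) r → ℤ) →
  ∑ h (tuples (cartesianProduct xs ys) r)
    ≡ ∑ (λ X → ∑ (λ Y → h (Vec.zip X Y)) (tuples ys r)) (tuples xs r)
∑-tuples-cartesianProduct xs ys zero    h = sym (ℤP.+-identityʳ _)
∑-tuples-cartesianProduct xs ys (suc r) h = begin
  ∑ h (tuples xys (suc r))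
    ≡⟨ ∑-tuples-suc xys r h ⟩
  ∑ (λ p → ∑ (λ Z → h (p ∷ Z)) (tuples xys r)) xys
    ≡⟨ ∑-cong xys (λ {p} _ → ∑-tuples-cartesianProduct xs ys r (h ∘ (p ∷_))) ⟩
  ∑ (λ p → ∑ (λ X → ∑ (λ Y → h (p ∷ Vec.zip X Y)) (tuples ys r)) (tuples xs r)) xys
    ≡⟨ ∑-cartesianProduct _ xs ys ⟩
  ∑ (λ x → ∑ (λ y → ∑ (λ X → ∑ (λ Y → h ((x , y) ∷ Vec.zip X Y)) (tuples ys r)) (tuples xs r)) ys) xs
    ≡⟨ ∑-cong xs (λ {x} _ → ∑-swap (λ y X → ∑ (λ Y → h ((x , y) ∷ Vec.zip X Y)) (tuples ys r)) ys (tuples xs r)) ⟩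
  ∑ (λ x → ∑ (λ X → ∑ (λ y → ∑ (λ Y → h (Vec.zip (x ∷ X) (y ∷ Y))) (tuples ys r)) ys) (tuples xs r)) xs
    ≡⟨ ∑-cong xs (λ {x} _ → ∑-cong (tuples xs r) (λ {X} _ →
         sym (∑-tuples-suc ys r (λ Y′ → h (Vec.zip (x ∷ X) Y′))))) ⟩
  ∑ (λ x → ∑ (λ X → ∑ (λ Y′ → h (Vec.zip (x ∷ X) Y′)) (tuples ys (suc r))) (tuples xs r)) xs
    ≡⟨ sym (∑-tuples-suc xs r (λ X′ → ∑ (λ Y′ → h (Vec.zip X′ Y′)) (tuples ys (suc r)))) ⟩
  ∑ (λ X′ → ∑ (λ Y′ → h (Vec.zip X′ Y′)) (tuples ys (suc r))) (tuples xs (suc r)) ∎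
  where
  open ≡-Reasoning
  xys = cartesianProduct xs ys

length-cartesianProduct : (xs : List A) (ys : List B) →
  length (cartesianProduct xs ys) ≡ length xs ℕ.* length ys
length-cartesianProduct []       ys = refl
length-cartesianProduct (x ∷ xs) ys =
  trans (ListP.length-++ (map (x ,_) ys))
        (cong₂ ℕ._+_ (ListP.length-map (x ,_) ys) (length-cartesianProduct xs ys))

-- (a b) / (m n) = (a / m) (b / n), also in the degenerate cases m = 0 or n = 0.
divℕ-* : (a b : ℤ) (m n : ℕ) → divℕ (a * b) (m ℕ.* n) ≡ divℕ a m ℚ.* divℕ b n
divℕ-* a b zero    n       = sym (ℚP.*-zeroˡ (divℕ b n))
divℕ-* a b (suc m) zero    rewrite ℕP.*-zeroʳ m = sym (ℚP.*-zeroʳ (divℕ a (suc m)))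
divℕ-* a b (suc m) (suc n) = sym (ℚP.toℚᵘ-injective (begin
  ℚ.toℚᵘ (ℚ.fromℚᵘ p ℚ.* ℚ.fromℚᵘ q)             ≈⟨ ℚP.toℚᵘ-homo-* (ℚ.fromℚᵘ p) (ℚ.fromℚᵘ q) ⟩
  ℚ.toℚᵘ (ℚ.fromℚᵘ p) ℚᵘ.* ℚ.toℚᵘ (ℚ.fromℚᵘ q)   ≈⟨ ℚᵘP.*-cong (ℚP.toℚᵘ-fromℚᵘ p) (ℚP.toℚᵘ-fromℚᵘ q) ⟩
  p ℚᵘ.* q                                         ≈⟨ ℚᵘP.≃-sym (ℚP.toℚᵘ-fromℚᵘ (p ℚᵘ.* q)) ⟩
  ℚ.toℚᵘ (ℚ.fromℚᵘ (p ℚᵘ.* q))                   ∎))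
  where
  open ℚᵘP.≃-Reasoning
  p = ℚᵘ.mkℚᵘ a m
  q = ℚᵘ.mkℚᵘ b n

χ̃ᵣ-⊗ : (r : ℕ) (R S : RawGL) → IsBoundedGPoset R → IsBoundedGPoset S →
  χ̃ᵣ r (R ⊗ S) ≡ χ̃ᵣ r R ℚ.* χ̃ᵣ r S
χ̃ᵣ-⊗ r R S R-bounded S-bounded =
  trans (cong₂ divℕ sums-factorise (length-cartesianProduct R.Gel S.Gel))
        (divℕ-* (∑ χ̃R (Hom R r)) (∑ χ̃S (Hom S r)) (length R.Gel) (length S.Gel))
  where
  module R = RawGL R
  module S = RawGL S
  module RS = RawGL (R ⊗ S)
  χ̃R : Vec R.G r → ℤ
  χ̃R X = redEuler R._≤_ R._≤?_ (fixedProper R X)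
  χ̃S : Vec S.G r → ℤ
  χ̃S Y = redEuler S._≤_ S._≤?_ (fixedProper S Y)
  χ̃RS : Vec RS.G r → ℤ
  χ̃RS Z = redEuler RS._≤_ RS._≤?_ (fixedProper (R ⊗ S) Z)
  sums-factorise : ∑ χ̃RS (Hom (R ⊗ S) r) ≡ ∑ χ̃R (Hom R r) * ∑ χ̃S (Hom S r)
  sums-factorise = begin
    ∑ χ̃RS (Hom (R ⊗ S) r)
      ≡⟨ ∑-Hom (R ⊗ S) r χ̃RS ⟩
    ∑ (λ Z → when (commutesᵇ (R ⊗ S) Z) (χ̃RS Z)) (tuples RS.Gel r)
      ≡⟨ ∑-tuples-cartesianProduct R.Gel S.Gel r _ ⟩
    ∑ (λ X → ∑ (λ Y → when (commutesᵇ (R ⊗ S) (Vec.zip X Y)) (χ̃RS (Vec.zip X Y))) (tuples S.Gel r)) (tuples R.Gel r)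
      ≡⟨ ∑-cong (tuples R.Gel r) (λ {X} _ → ∑-cong (tuples S.Gel r) (λ {Y} _ →
           trans (cong₂ when (commutesᵇ-zip R S X Y) (χ̃-fixedProper-⊗ R S R-bounded S-bounded X Y))
                 (when-∧ (commutesᵇ R X) (commutesᵇ S Y) (χ̃R X) (χ̃S Y)))) ⟩
    ∑ (λ X → ∑ (λ Y → when (commutesᵇ R X) (χ̃R X) * when (commutesᵇ S Y) (χ̃S Y)) (tuples S.Gel r)) (tuples R.Gel r)
      ≡⟨ ∑-product _ _ (tuples R.Gel r) (tuples S.Gel r) ⟩
    ∑ (λ X → when (commutesᵇ R X) (χ̃R X)) (tuples R.Gel r) * ∑ (λ Y → when (commutesᵇ S Y) (χ̃S Y)) (tuples S.Gel r)
      ≡⟨ sym (cong₂ _*_ (∑-Hom R r χ̃R) (∑-Hom S r χ̃S)) ⟩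
    ∑ χ̃R (Hom R r) * ∑ χ̃S (Hom S r) ∎
    where open ≡-Reasoning

χ̃ᵣ-∏ : (r k : ℕ) (R : Fin (suc k) → RawGL) → (∀ i → IsBoundedGPoset (R i)) →
  χ̃ᵣ r (∏GL k R) ≡ ∏ℚ k (λ i → χ̃ᵣ r (R i))
χ̃ᵣ-∏ r zero    R bounded = refl
χ̃ᵣ-∏ r (suc k) R bounded =
  trans (χ̃ᵣ-⊗ r (R zero) (∏GL k (R ∘ suc)) (bounded zero) (∏GL-isBoundedGPoset k (R ∘ suc) (bounded ∘ suc)))
        (cong (χ̃ᵣ r (R zero) ℚ.*_) (χ̃ᵣ-∏ r k (R ∘ suc) (bounded ∘ suc)))

lemma2p3 : (k : ℕ) (G : Fin (suc k) → FinGroup) (L : Fin (suc k) → FinLattice)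
    (A : (i : Fin (suc k)) → Action (G i) (L i)) →
    (∀ i → FinLattice.⊥ (L i) ≢ FinLattice.⊤ (L i)) →
    (r : ℕ) → 1 ≤ r →
    χ̃ᵣ r (∏GL k (λ i → toRaw (G i) (L i) (A i)))
      ≡ ∏ℚ k (λ i → χ̃ᵣ r (toRaw (G i) (L i) (A i)))
lemma2p3 k G L A ⊥≢⊤ r _ =
  χ̃ᵣ-∏ r k (λ i → toRaw (G i) (L i) (A i)) (λ i → toRaw-isBoundedGPoset (G i) (L i) (A i) (⊥≢⊤ i))
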